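{- For any finite simple graph $G$, $\operatorname{indmatch} W(G)=\alpha(G)$ and $\operatorname{cochord} W(G)=\chi(\overline G)$.
   Context: For $G$ on $n$ vertices, $W(G)$ is the graph on $2n$ vertices obtained by attaching to each vertex $v$ of $G$ a new vertex of degree 1 adjacent only to $v$ (a pendant edge). $\alpha(G)$ is the independence number of $G$, $\overline G$ is the complement of $G$, and $\chi$ is chromatic number. An induced matching is a set of pairwise disjoint edges forming an induced subgraph; $\operatorname{indmatch}$ is its maximum size. A graph is co-chordal if its complement is chordal (every induced cycle has length 3); $\operatorname{cochord} H$ is the minimum number of co-chordal subgraphs of $H$ whose edge sets cover $E(H)$. -}

module Defs where

open import Data.Nat using (ℕ; zero; suc; _+_; _≤_; _%_)
open import Data.Fin using (Fin; toℕ; splitAt; _≟_)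
open import Data.Bool using (Bool; true; false; T)
open import Data.Sum using (_⊎_; inj₁; inj₂)
open import Data.Product using (_×_; _,_; Σ; ∃)
open import Relation.Nullary using (¬_; yes; no; Dec)
open import Relation.Nullary.Decidable using (⌊_⌋)
open import Relation.Binary.PropositionalEquality using (_≡_; _≢_; refl; sym)

record Graph (n : ℕ) : Set where
  field
    Adj     : Fin n → Fin n → Bool
    adj-sym : ∀ u v → Adj u v ≡ Adj v u
    irrefl  : ∀ u → Adj u u ≡ false
open Graph public

Edge : ∀ {n} → Graph n → Fin n → Fin n → Set
Edge G u v = T (Adj G u v)

private
  not : Bool → Bool
  not true  = false
  not false = true

  and : Bool → Bool → Bool
  and true b  = b
  and false _ = false

  eqb : ∀ {n} → Fin n → Fin n → Bool
  eqb u v = ⌊ u ≟ v ⌋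

  eqb-sym : ∀ {n} (u v : Fin n) → eqb u v ≡ eqb v u
  eqb-sym u v with u ≟ v | v ≟ u
  ... | yes _ | yes _ = refl
  ... | no _  | no _  = refl
  ... | yes p | no ¬q = Data.Empty.⊥-elim (¬q (sym p))
    where import Data.Empty
  ... | no ¬p | yes q = Data.Empty.⊥-elim (¬p (sym q))
    where import Data.Empty

  eqb-refl : ∀ {n} (u : Fin n) → eqb u u ≡ true
  eqb-refl u with u ≟ u
  ... | yes _ = refl
  ... | no ¬p = Data.Empty.⊥-elim (¬p refl)
    where import Data.Empty

complement : ∀ {n} → Graph n → Graph n
complement {n} G = record { Adj = A ; adj-sym = s ; irrefl = i }
  where
  A : Fin n → Fin n → Bool
  A u v = and (not (eqb u v)) (not (Adj G u v))
  s : ∀ u v → A u v ≡ A v u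
  s u v rewrite eqb-sym u v | Graph.adj-sym G u v = refl
  i : ∀ u → A u u ≡ false
  i u rewrite eqb-refl u = refl

-- Vertex set Fin (n + n): the first copy (via splitAt, inj₁ v) is the
-- original vertex v, the second copy (inj₂ v) is the new pendant vertex
-- attached to v.

private
  WAdj : ∀ {n} → Graph n → Fin n ⊎ Fin n → Fin n ⊎ Fin n → Bool
  WAdj G (inj₁ u) (inj₁ v) = Adj G u v
  WAdj G (inj₁ u) (inj₂ v) = eqb u v
  WAdj G (inj₂ u) (inj₁ v) = eqb u v
  WAdj G (inj₂ u) (inj₂ v) = false

  WAdj-sym : ∀ {n} (G : Graph n) x y → WAdj G x y ≡ WAdj G y x
  WAdj-sym G (inj₁ u) (inj₁ v) = Graph.adj-sym G u v
  WAdj-sym G (inj₁ u) (inj₂ v) = eqb-sym u v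
  WAdj-sym G (inj₂ u) (inj₁ v) = eqb-sym u v
  WAdj-sym G (inj₂ u) (inj₂ v) = refl

  WAdj-irr : ∀ {n} (G : Graph n) x → WAdj G x x ≡ false
  WAdj-irr G (inj₁ u) = irrefl G u
  WAdj-irr G (inj₂ u) = refl

W : ∀ {n} → Graph n → Graph (n + n)
W {n} G = record
  { Adj    = λ x y → WAdj G (splitAt n x) (splitAt n y)
  ; adj-sym = λ x y → WAdj-sym G (splitAt n x) (splitAt n y)
  ; irrefl = λ x → WAdj-irr G (splitAt n x)
  }

record IndependentSet {n} (G : Graph n) (k : ℕ) : Set where
  field
    vtx       : Fin k → Fin n
    injective : ∀ i j → vtx i ≡ vtx j → i ≡ j
    indep     : ∀ i j → ¬ Edge G (vtx i) (vtx j)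

IsIndependenceNumber : ∀ {n} → Graph n → ℕ → Set
IsIndependenceNumber G a =
  IndependentSet G a × (∀ k → IndependentSet G k → k ≤ a)

Far : ∀ {n} → Graph n → Fin n → Fin n → Set
Far G x y = x ≢ y × ¬ Edge G x y

-- an induced matching with k edges {end₁ i, end₂ i}, i : Fin k:
-- each is an edge, and for distinct i ≠ j all endpoints of edge i are
-- distinct from and non-adjacent to all endpoints of edge j
-- (so the edges are pairwise disjoint and the subgraph induced by their
-- endpoints has exactly these edges).
record InducedMatching {n} (G : Graph n) (k : ℕ) : Set where
  field
    end₁ end₂ : Fin k → Fin n
    isEdge    : ∀ i → Edge G (end₁ i) (end₂ i)
    induced   : ∀ i j → i ≢ j →
                Far G (end₁ i) (end₁ j) × Far G (end₁ i) (end₂ j) ×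
                Far G (end₂ i) (end₁ j) × Far G (end₂ i) (end₂ j)

IsIndMatchNumber : ∀ {n} → Graph n → ℕ → Set
IsIndMatchNumber G m =
  InducedMatching G m × (∀ k → InducedMatching G k → k ≤ m)

record Colouring {n} (G : Graph n) (k : ℕ) : Set where
  field
    colour : Fin n → Fin k
    proper : ∀ u v → Edge G u v → colour u ≢ colour v

IsChromaticNumber : ∀ {n} → Graph n → ℕ → Set
IsChromaticNumber G c =
  Colouring G c × (∀ k → Colouring G k → c ≤ k)

Consecutive : ∀ l → Fin (4 + l) → Fin (4 + l) → Set
Consecutive l i j = (toℕ j ≡ suc (toℕ i) % (4 + l)) ⊎ (toℕ i ≡ suc (toℕ j) % (4 + l))

record LongInducedCycle {n} (G : Graph n) (l : ℕ) : Set where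
  field
    cyc       : Fin (4 + l) → Fin n
    injective : ∀ i j → cyc i ≡ cyc j → i ≡ j
    edges     : ∀ i j → Consecutive l i j → Edge G (cyc i) (cyc j)
    nonEdges  : ∀ i j → Edge G (cyc i) (cyc j) → Consecutive l i j

Chordal : ∀ {n} → Graph n → Set
Chordal G = ∀ l → ¬ LongInducedCycle G l

CoChordal : ∀ {n} → Graph n → Set
CoChordal G = Chordal (complement G)

record Subgraph {m} (H : Graph m) : Set where
  field
    size      : ℕ
    graph     : Graph size
    emb       : Fin size → Fin m
    injective : ∀ u v → emb u ≡ emb v → u ≡ v
    edgePres  : ∀ u v → Edge graph u v → Edge H (emb u) (emb v)

CoversEdge : ∀ {m} {H : Graph m} → Subgraph H → Fin m → Fin m → Set
CoversEdge S x y =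
  ∃ λ u → ∃ λ v → Subgraph.emb S u ≡ x × Subgraph.emb S v ≡ y ×
                  Edge (Subgraph.graph S) u v

record CoChordalCover {m} (H : Graph m) (k : ℕ) : Set where
  field
    sub       : Fin k → Subgraph H
    coChordal : ∀ i → CoChordal (Subgraph.graph (sub i))
    covers    : ∀ x y → Edge H x y → ∃ λ i → CoversEdge (sub i) x y

IsCochordNumber : ∀ {m} → Graph m → ℕ → Set
IsCochordNumber H c =
  CoChordalCover H c × (∀ k → CoChordalCover H k → c ≤ k)

-- The pendant edges of W(G) at u and v are separated (their four endpoints pairwise distinct and
-- non-adjacent) exactly when u and v are distinct and non-adjacent in G, and every edge of W(G)
-- meets the original copy of G.  So the pendant edges at an independent set of G form an induced
-- matching of W(G), and one original endpoint per edge of an induced matching of W(G) gives an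
-- independent set of G.  A co-chordal graph contains no two separated edges, since the complement
-- of 2K₂ is the 4-cycle; hence colouring u by a part covering its pendant edge properly colours the
-- complement of G.  Conversely, a colour class K of the complement is a clique of G, and the edges
-- of W(G) meeting K form a split graph (K a clique, the rest independent), whose complement is again
-- split and thus chordal; one such part per colour covers W(G).

module Submission where

open import Defs
open import Data.Nat using (ℕ; zero; suc; _+_; _%_; _≤_)
open import Data.Fin using (Fin; _≟_; toℕ; splitAt; _↑ˡ_; _↑ʳ_)
open import Data.Fin.Properties using (splitAt-↑ˡ; splitAt-↑ʳ; splitAt⁻¹-↑ˡ; splitAt⁻¹-↑ʳ; ↑ˡ-injective; ↑ʳ-injective)
open import Data.Fin.Patterns using (0F; 1F; 2F; 3F; 4F)
open import Data.Bool using (Bool; true; false; T; _∧_; _∨_)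
open import Data.Bool.Properties using (∨-comm; ∧-zeroʳ; T-∧; T-∨)
open import Function using (flip)
open import Function.Bundles using (_⇔_; mk⇔; Equivalence)
open import Data.Unit using (tt)
open import Data.Sum using (_⊎_; inj₁; inj₂; [_,_]′; map)
open import Data.Product using (_×_; _,_; proj₁; proj₂; ∃)
open import Data.Empty using (⊥-elim)
open import Relation.Nullary using (¬_; yes; no)
open import Relation.Nullary.Decidable using (T?; decidable-stable; ⌊_⌋; toWitness; fromWitness)
open import Relation.Binary.PropositionalEquality

module _ {m} (H : Graph m) {x y : Fin m} where

  Edge-sym : Edge H x y → Edge H y x
  Edge-sym = subst T (adj-sym H x y)

  Edge⇒≢ : Edge H x y → x ≢ y
  Edge⇒≢ e refl = subst T (irrefl H x) e

  Far-sym : Far H x y → Far H y x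
  Far-sym (x≢y , ¬xy) = (λ y≡x → x≢y (sym y≡x)) , (λ yx → ¬xy (subst T (adj-sym H y x) yx))

  complement-edge : Far H x y → Edge (complement H) x y
  complement-edge (x≢y , ¬xy) with x ≟ y | Adj H x y | ¬xy
  ... | yes x≡y | _     | _   = ⊥-elim (x≢y x≡y)
  ... | no _    | true  | ¬tt = ⊥-elim (¬tt tt)
  ... | no _    | false | _   = tt

  complement-edge⁻¹ : Edge (complement H) x y → Far H x y
  complement-edge⁻¹ e with x ≟ y | Adj H x y
  ... | no x≢y | false = x≢y , λ ()

  Edge⇒Far-complement : Edge H x y → Far (complement H) x y
  Edge⇒Far-complement e = Edge⇒≢ e , λ ce → proj₂ (complement-edge⁻¹ ce) e

  ¬complement-edge⇒edge : x ≢ y → ¬ Edge (complement H) x y → Edge H x y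
  ¬complement-edge⇒edge x≢y ¬ce =
    decidable-stable (T? (Adj H x y)) λ ¬e → ¬ce (complement-edge (x≢y , ¬e))

IsClique IsIndependent : ∀ {m} → Graph m → (Fin m → Set) → Set
IsClique H P = ∀ x y → x ≢ y → P x → P y → Edge H x y
IsIndependent H P = ∀ x y → P x → P y → ¬ Edge H x y

record SplitPartition {m} (H : Graph m) : Set where
  field
    part        : Fin m → Bool
    independent : IsIndependent H (λ x → T (part x))
    clique      : IsClique H (λ x → ¬ T (part x))

module _ {m} {H : Graph m} {l} (C : LongInducedCycle H l) where
  open LongInducedCycle C

  cycle-far : ∀ i j → i ≢ j → ¬ Consecutive l i j → Far H (cyc i) (cyc j)
  cycle-far i j i≢j ¬ij = (λ e → i≢j (injective i j e)) , (λ e → ¬ij (nonEdges i j e))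

  far₀₂ : Far H (cyc 0F) (cyc 2F)
  far₀₂ = cycle-far 0F 2F (λ ()) λ { (inj₁ ()) ; (inj₂ ()) }

  far₁₃ : Far H (cyc 1F) (cyc 3F)
  far₁₃ = cycle-far 1F 3F (λ ()) (not-consecutive l)
    where
    not-consecutive : ∀ l → ¬ Consecutive l 1F 3F
    not-consecutive _       (inj₁ ())
    not-consecutive zero    (inj₂ ())
    not-consecutive (suc _) (inj₂ ())

far₁₄ : ∀ {m} {H : Graph m} {l} (C : LongInducedCycle H (suc l)) →
        Far H (LongInducedCycle.cyc C 1F) (LongInducedCycle.cyc C 4F)
far₁₄ {l = l} C = cycle-far C 1F 4F (λ ()) (not-consecutive l)
  where
  not-consecutive : ∀ l → ¬ Consecutive (suc l) 1F 4F
  not-consecutive _       (inj₁ ())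
  not-consecutive zero    (inj₂ ())
  not-consecutive (suc _) (inj₂ ())

open LongInducedCycle using (cyc; edges)

module _ {m} {H : Graph m} (P : SplitPartition H) where
  open SplitPartition P

  private
    edge-leaves-part : ∀ {x y} → Edge H x y → T (part x) → ¬ T (part y)
    edge-leaves-part {x} {y} e px py = independent x y px py e

    far-enters-part : ∀ {x y} → Far H x y → ¬ T (part x) → T (part y)
    far-enters-part {x} {y} (x≢y , ¬xy) ¬px =
      decidable-stable (T? (part y)) λ ¬py → ¬xy (clique x y x≢y ¬px ¬py)

  -- Either the far pair c₀, c₂ lies outside the independent part, or two adjacent vertices lie in it.
  split⇒chordal : Chordal H
  split⇒chordal l C with T? (part (cyc C 1F))
  ... | yes p₁ = edge-leaves-part (edges C 1F 2F (inj₁ refl)) p₁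
                   (far-enters-part (far₀₂ C) (edge-leaves-part (edges C 1F 0F (inj₂ refl)) p₁))
  split⇒chordal zero C | no ¬p₁ =
    edge-leaves-part (edges C 3F 2F (inj₂ refl)) p₃
      (far-enters-part (far₀₂ C) (edge-leaves-part (edges C 3F 0F (inj₁ refl)) p₃))
    where p₃ = far-enters-part (far₁₃ C) ¬p₁
  split⇒chordal (suc l) C | no ¬p₁ =
    edge-leaves-part (edges C 3F 4F (inj₁ refl))
      (far-enters-part (far₁₃ C) ¬p₁) (far-enters-part (far₁₄ C) ¬p₁)

module _ {m} (H : Graph m) {p₀ p₁ p₂ p₃ : Fin m}
         (e₀₁ : Edge H p₀ p₁) (e₁₂ : Edge H p₁ p₂) (e₂₃ : Edge H p₂ p₃) (e₃₀ : Edge H p₃ p₀)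
         (far₀₂ : Far H p₀ p₂) (far₁₃ : Far H p₁ p₃) where

  private
    c : Fin 4 → Fin m
    c 0F = p₀
    c 1F = p₁
    c 2F = p₂
    c 3F = p₃

    nonConsecutive : ∀ {i j} → toℕ j ≢ suc (toℕ i) % 4 → toℕ i ≢ suc (toℕ j) % 4 → ¬ Consecutive 0 i j
    nonConsecutive a b = [ a , b ]′

    relation : ∀ i j → (Consecutive 0 i j × Edge H (c i) (c j))
                     ⊎ (¬ Consecutive 0 i j × (i ≡ j ⊎ Far H (c i) (c j)))
    relation 0F 0F = inj₂ (nonConsecutive (λ ()) (λ ()) , inj₁ refl)
    relation 1F 1F = inj₂ (nonConsecutive (λ ()) (λ ()) , inj₁ refl)
    relation 2F 2F = inj₂ (nonConsecutive (λ ()) (λ ()) , inj₁ refl)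
    relation 3F 3F = inj₂ (nonConsecutive (λ ()) (λ ()) , inj₁ refl)
    relation 0F 2F = inj₂ (nonConsecutive (λ ()) (λ ()) , inj₂ far₀₂)
    relation 2F 0F = inj₂ (nonConsecutive (λ ()) (λ ()) , inj₂ (Far-sym H far₀₂))
    relation 1F 3F = inj₂ (nonConsecutive (λ ()) (λ ()) , inj₂ far₁₃)
    relation 3F 1F = inj₂ (nonConsecutive (λ ()) (λ ()) , inj₂ (Far-sym H far₁₃))
    relation 0F 1F = inj₁ (inj₁ refl , e₀₁)
    relation 1F 2F = inj₁ (inj₁ refl , e₁₂)
    relation 2F 3F = inj₁ (inj₁ refl , e₂₃)
    relation 3F 0F = inj₁ (inj₁ refl , e₃₀)
    relation 1F 0F = inj₁ (inj₂ refl , Edge-sym H e₀₁)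
    relation 2F 1F = inj₁ (inj₂ refl , Edge-sym H e₁₂)
    relation 3F 2F = inj₁ (inj₂ refl , Edge-sym H e₂₃)
    relation 0F 3F = inj₁ (inj₂ refl , Edge-sym H e₃₀)

  inducedC₄ : LongInducedCycle H 0
  inducedC₄ = record
    { cyc = c ; injective = distinct ; edges = consecutive⇒edge ; nonEdges = edge⇒consecutive }
    where
    distinct : ∀ i j → c i ≡ c j → i ≡ j
    distinct i j ci≡cj with relation i j
    ... | inj₁ (_ , e)                = ⊥-elim (Edge⇒≢ H e ci≡cj)
    ... | inj₂ (_ , inj₁ i≡j)         = i≡j
    ... | inj₂ (_ , inj₂ (ci≢cj , _)) = ⊥-elim (ci≢cj ci≡cj)
    consecutive⇒edge : ∀ i j → Consecutive 0 i j → Edge H (c i) (c j)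
    consecutive⇒edge i j ij with relation i j
    ... | inj₁ (_ , e)   = e
    ... | inj₂ (¬ij , _) = ⊥-elim (¬ij ij)
    edge⇒consecutive : ∀ i j → Edge H (c i) (c j) → Consecutive 0 i j
    edge⇒consecutive i j e with relation i j
    ... | inj₁ (ij , _)            = ij
    ... | inj₂ (_ , inj₁ refl)     = ⊥-elim (Edge⇒≢ H e refl)
    ... | inj₂ (_ , inj₂ (_ , ¬e)) = ⊥-elim (¬e e)

Separated : ∀ {m} → Graph m → Fin m → Fin m → Fin m → Fin m → Set
Separated H x x′ y y′ = Far H x y × Far H x y′ × Far H x′ y × Far H x′ y′

module _ {m} {H : Graph m} (S : Subgraph H) where
  open Subgraph S

  Subgraph-far : ∀ {s t} → Far H (emb s) (emb t) → Far graph s t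
  Subgraph-far (≢ , ¬e) = (λ s≡t → ≢ (cong emb s≡t)) , (λ e → ¬e (edgePres _ _ e))

  -- The complement of 2K₂ is the 4-cycle.
  covers-separated⇒¬coChordal : ∀ {x x′ y y′} → CoversEdge S x x′ → CoversEdge S y y′ →
                                 Separated H x x′ y y′ → ¬ CoChordal graph
  covers-separated⇒¬coChordal (a , a′ , refl , refl , aa′) (b , b′ , refl , refl , bb′)
                              (far-ab , far-ab′ , far-a′b , far-a′b′) chordal =
    chordal 0 (inducedC₄ (complement graph)
      (co-edge far-ab) (Edge-sym (complement graph) (co-edge far-a′b)) (co-edge far-a′b′)
      (Edge-sym (complement graph) (co-edge far-ab′))
      (Edge⇒Far-complement graph aa′) (Edge⇒Far-complement graph bb′))
    where
    co-edge : ∀ {s t} → Far H (emb s) (emb t) → Edge (complement graph) s t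
    co-edge far = complement-edge graph (Subgraph-far far)

edgesMeeting : ∀ {m} → Graph m → (Fin m → Bool) → Graph m
edgesMeeting H C = record
  { Adj     = λ x y → (C x ∨ C y) ∧ Adj H x y
  ; adj-sym = λ x y → cong₂ _∧_ (∨-comm (C x) (C y)) (adj-sym H x y)
  ; irrefl  = λ x → trans (cong ((C x ∨ C x) ∧_) (irrefl H x)) (∧-zeroʳ _)
  }

module _ {m} (H : Graph m) (C : Fin m → Bool) {x y : Fin m} where

  edgesMeeting-edge : T (C x) ⊎ T (C y) → Edge H x y → Edge (edgesMeeting H C) x y
  edgesMeeting-edge meets e = Equivalence.from T-∧ (Equivalence.from T-∨ meets , e)

  edgesMeeting-meets : Edge (edgesMeeting H C) x y → T (C x) ⊎ T (C y)
  edgesMeeting-meets e = Equivalence.to T-∨ (proj₁ (Equivalence.to T-∧ e))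

  edgesMeeting-⊆ : Edge (edgesMeeting H C) x y → Edge H x y
  edgesMeeting-⊆ e = proj₂ (Equivalence.to T-∧ e)

-- In the complement, C is independent and the rest is a clique.
edgesMeeting-coChordal : ∀ {m} (H : Graph m) (C : Fin m → Bool) →
                         IsClique H (λ x → T (C x)) → CoChordal (edgesMeeting H C)
edgesMeeting-coChordal H C clique = split⇒chordal record
  { part        = C
  ; independent = independent
  ; clique      = λ x y x≢y ¬cx ¬cy → complement-edge S (x≢y , ¬edge ¬cx ¬cy)
  }
  where
  S = edgesMeeting H C
  independent : IsIndependent (complement S) (λ x → T (C x))
  independent x y cx cy e with complement-edge⁻¹ S e
  ... | x≢y , ¬xy = ¬xy (edgesMeeting-edge H C (inj₁ cx) (clique x y x≢y cx cy))
  ¬edge : ∀ {x y} → ¬ T (C x) → ¬ T (C y) → ¬ Edge S x y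
  ¬edge ¬cx ¬cy e = [ ¬cx , ¬cy ]′ (edgesMeeting-meets H C e)

spanningSubgraph : ∀ {m} {H : Graph m} (S : Graph m) → (∀ x y → Edge S x y → Edge H x y) → Subgraph H
spanningSubgraph S S⊆H = record
  { size = _ ; graph = S ; emb = λ x → x ; injective = λ _ _ x≡y → x≡y ; edgePres = S⊆H }

module _ {n} (G : Graph n) where

  pairwiseFar⇒independentSet : ∀ {k} (f : Fin k → Fin n) → (∀ i j → i ≢ j → Far G (f i) (f j)) →
                               IndependentSet G k
  pairwiseFar⇒independentSet f far = record { vtx = f ; injective = injective ; indep = indep }
    where
    injective : ∀ i j → f i ≡ f j → i ≡ j
    injective i j fi≡fj = decidable-stable (i ≟ j) λ i≢j → proj₁ (far i j i≢j) fi≡fj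
    indep : ∀ i j → ¬ Edge G (f i) (f j)
    indep i j with i ≟ j
    ... | yes refl = λ e → Edge⇒≢ G e refl
    ... | no i≢j   = proj₂ (far i j i≢j)

  independentSet-far : ∀ {k} (I : IndependentSet G k) → ∀ i j → i ≢ j →
                       Far G (IndependentSet.vtx I i) (IndependentSet.vtx I j)
  independentSet-far I i j i≢j = (λ eq → i≢j (injective i j eq)) , indep i j
    where open IndependentSet I

separated-far : ∀ {m} (H : Graph m) {x x′ y y′ a b} → Separated H x x′ y y′ →
                x ≡ a ⊎ x′ ≡ a → y ≡ b ⊎ y′ ≡ b → Far H a b
separated-far _ (far , _ , _ , _) (inj₁ refl) (inj₁ refl) = far
separated-far _ (_ , far , _ , _) (inj₁ refl) (inj₂ refl) = far
separated-far _ (_ , _ , far , _) (inj₂ refl) (inj₁ refl) = far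
separated-far _ (_ , _ , _ , far) (inj₂ refl) (inj₂ refl) = far

extremal-⇔ : ∀ {P Q : ℕ → Set} (_≺_ : ℕ → ℕ → Set) →
             (∀ {k} → P k → Q k) → (∀ {k} → Q k → P k) →
             ∀ m → (P m × (∀ k → P k → k ≺ m)) ⇔ (Q m × (∀ k → Q k → k ≺ m))
extremal-⇔ _ P⇒Q Q⇒P m = mk⇔ (λ (p , best) → P⇒Q p , λ k q → best k (Q⇒P q))
                             (λ (q , best) → Q⇒P q , λ k p → best k (P⇒Q p))

module _ {n : ℕ} where

  original pendant : Fin n → Fin (n + n)
  original u = u ↑ˡ n
  pendant  u = n ↑ʳ u

  data WVertex : Fin (n + n) → Set where
    is-original : ∀ u → WVertex (original u)
    is-pendant  : ∀ u → WVertex (pendant u)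

  classify : ∀ x → WVertex x
  classify x with splitAt n x in eq
  ... | inj₁ u = subst WVertex (splitAt⁻¹-↑ˡ eq) (is-original u)
  ... | inj₂ u = subst WVertex (splitAt⁻¹-↑ʳ eq) (is-pendant u)

  original≢pendant : ∀ {u v} → original u ≢ pendant v
  original≢pendant {u} {v} eq
    with trans (sym (splitAt-↑ˡ n u n)) (trans (cong (splitAt n) eq) (splitAt-↑ʳ n n v))
  ... | ()

  onOriginals : (Fin n → Bool) → Fin (n + n) → Bool
  onOriginals P x = [ P , (λ _ → false) ]′ (splitAt n x)

  onOriginals-original : ∀ P u → onOriginals P (original u) ≡ P u
  onOriginals-original P u rewrite splitAt-↑ˡ n u n = refl

  onOriginals-pendant : ∀ P u → onOriginals P (pendant u) ≡ false
  onOriginals-pendant P u rewrite splitAt-↑ʳ n n u = refl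

module _ {n} (G : Graph n) where

  W-original-original : ∀ u v → Adj (W G) (original u) (original v) ≡ Adj G u v
  W-original-original u v rewrite splitAt-↑ˡ n u n | splitAt-↑ˡ n v n = refl

  W-original-pendant : ∀ u v → Adj (W G) (original u) (pendant v) ≡ ⌊ u ≟ v ⌋
  W-original-pendant u v rewrite splitAt-↑ˡ n u n | splitAt-↑ʳ n n v = refl

  W-pendant-original : ∀ u v → Adj (W G) (pendant u) (original v) ≡ ⌊ u ≟ v ⌋
  W-pendant-original u v rewrite splitAt-↑ʳ n n u | splitAt-↑ˡ n v n = refl

  W-pendant-pendant : ∀ u v → Adj (W G) (pendant u) (pendant v) ≡ false
  W-pendant-pendant u v rewrite splitAt-↑ʳ n n u | splitAt-↑ʳ n n v = refl

  pendantEdge : ∀ u → Edge (W G) (original u) (pendant u)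
  pendantEdge u = subst T (sym (W-original-pendant u u)) (fromWitness refl)

  W-edge-meets-original : ∀ {x y} → Edge (W G) x y → ∃ λ u → x ≡ original u ⊎ y ≡ original u
  W-edge-meets-original {x} {y} e with classify {n} x | classify {n} y
  ... | is-original u | _             = u , inj₁ refl
  ... | is-pendant _  | is-original v = v , inj₂ refl
  ... | is-pendant u  | is-pendant v  = ⊥-elim (subst T (W-pendant-pendant u v) e)

  far-originals : ∀ {u v} → Far (W G) (original u) (original v) ⇔ Far G u v
  far-originals {u} {v} = mk⇔
    (λ (≢ , ¬e) → (λ u≡v → ≢ (cong original u≡v)) , (λ e → ¬e (subst T (sym (W-original-original u v)) e)))
    (λ (≢ , ¬e) → (λ eq → ≢ (↑ˡ-injective n u v eq)) , (λ e → ¬e (subst T (W-original-original u v) e)))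

  pendantEdges-separated : ∀ {u v} → Far G u v →
                           Separated (W G) (original u) (pendant u) (original v) (pendant v)
  pendantEdges-separated {u} {v} far@(u≢v , _) =
      Equivalence.from far-originals far
    , (original≢pendant , λ e → u≢v (toWitness (subst T (W-original-pendant u v) e)))
    , ((λ eq → original≢pendant (sym eq)) , λ e → u≢v (toWitness (subst T (W-pendant-original u v) e)))
    , ((λ eq → u≢v (↑ʳ-injective n u v eq)) , λ e → subst T (W-pendant-pendant u v) e)

  onOriginals-clique : ∀ P → IsClique G (λ u → T (P u)) → IsClique (W G) (λ x → T (onOriginals P x))
  onOriginals-clique P clique x y x≢y px py with classify {n} x | classify {n} y
  ... | is-original u | is-original v = subst T (sym (W-original-original u v))
          (clique u v (λ u≡v → x≢y (cong original u≡v))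
                      (subst T (onOriginals-original P u) px) (subst T (onOriginals-original P v) py))
  ... | is-pendant u  | _             = ⊥-elim (subst T (onOriginals-pendant P u) px)
  ... | is-original _ | is-pendant v  = ⊥-elim (subst T (onOriginals-pendant P v) py)

module _ {n} (G : Graph n) {k : ℕ} where

  independentSet⇒inducedMatching : IndependentSet G k → InducedMatching (W G) k
  independentSet⇒inducedMatching I = record
    { end₁    = λ i → original (vtx i)
    ; end₂    = λ i → pendant (vtx i)
    ; isEdge  = λ i → pendantEdge G (vtx i)
    ; induced = λ i j i≢j → pendantEdges-separated G (independentSet-far G I i j i≢j)
    }
    where open IndependentSet I

  inducedMatching⇒independentSet : InducedMatching (W G) k → IndependentSet G k
  inducedMatching⇒independentSet M = pairwiseFar⇒independentSet G u far
    where
    open InducedMatching M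
    u : Fin k → Fin n
    u i = proj₁ (W-edge-meets-original G (isEdge i))
    far : ∀ i j → i ≢ j → Far G (u i) (u j)
    far i j i≢j = Equivalence.to (far-originals G) (separated-far (W G) (induced i j i≢j)
      (proj₂ (W-edge-meets-original G (isEdge i)))
      (proj₂ (W-edge-meets-original G (isEdge j))))

  cover⇒colouring : CoChordalCover (W G) k → Colouring (complement G) k
  cover⇒colouring cover = record { colour = colour ; proper = proper }
    where
    open CoChordalCover cover
    covered : ∀ u → ∃ λ i → CoversEdge (sub i) (original u) (pendant u)
    covered u = covers _ _ (pendantEdge G u)
    colour : Fin n → Fin k
    colour u = proj₁ (covered u)
    proper : ∀ u v → Edge (complement G) u v → colour u ≢ colour v
    proper u v e same =
      covers-separated⇒¬coChordal (sub (colour u)) (proj₂ (covered u))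
        (subst (λ i → CoversEdge (sub i) (original v) (pendant v)) (sym same) (proj₂ (covered v)))
        (pendantEdges-separated G (complement-edge⁻¹ G e)) (coChordal (colour u))

  colouring⇒cover : Colouring (complement G) k → CoChordalCover (W G) k
  colouring⇒cover col = record { sub = part ; coChordal = coChordal ; covers = covers }
    where
    open Colouring col
    colourClass : Fin k → Fin n → Bool
    colourClass i u = ⌊ colour u ≟ i ⌋
    colourClass-clique : ∀ i → IsClique G (λ u → T (colourClass i u))
    colourClass-clique i u v u≢v ui vi = ¬complement-edge⇒edge G u≢v λ e →
      proper u v e (trans (toWitness ui) (sym (toWitness vi)))
    class : Fin k → Fin (n + n) → Bool
    class i = onOriginals (colourClass i)
    part : Fin k → Subgraph (W G)
    part i = spanningSubgraph (edgesMeeting (W G) (class i)) (λ _ _ → edgesMeeting-⊆ (W G) (class i))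
    coChordal : ∀ i → CoChordal (Subgraph.graph (part i))
    coChordal i = edgesMeeting-coChordal (W G) (class i)
                    (onOriginals-clique G (colourClass i) (colourClass-clique i))
    covers : ∀ x y → Edge (W G) x y → ∃ λ i → CoversEdge (part i) x y
    covers x y e with W-edge-meets-original G e
    ... | u , meets =
      colour u , x , y , refl , refl , edgesMeeting-edge (W G) (class (colour u)) (map inClass inClass meets) e
      where
      inClass : ∀ {z} → z ≡ original u → T (class (colour u) z)
      inClass refl = subst T (sym (onOriginals-original (colourClass (colour u)) u)) (fromWitness refl)

lemma4p10 : ∀ (n : ℕ) (G : Graph n) →
    (∀ k → IsIndMatchNumber (W G) k ⇔ IsIndependenceNumber G k) ×
    (∀ k → IsCochordNumber (W G) k ⇔ IsChromaticNumber (complement G) k)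
lemma4p10 n G =
    extremal-⇔ _≤_ (inducedMatching⇒independentSet G) (independentSet⇒inducedMatching G)
  , extremal-⇔ (flip _≤_) (cover⇒colouring G) (colouring⇒cover G)
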